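{- Let $(R_n)_{n\ge 0}$ be defined by $R_0=1$, $R_1=2$, $R_2=6$ and $R_n = 5R_{n-1} - 6R_{n-2} + R_{n-3}$ for $n\ge 3$ (so $R_n$ begins $1,2,6,19,61,197,638,2069,\dots$). Then for every $n\ge 0$, \[ R_n \;=\; 2 \sum_{\substack{k \ge 0\\ k \equiv 0 \ (\mathrm{mod}\ 7)}} \binom{2n}{n+k} \;-\; \sum_{\substack{k\ge 0\\ k \equiv 3,4 \ (\mathrm{mod}\ 7)}} \binom{2n}{n+k} \;-\; \binom{2n}{n}. \]
   Context: Binomial coefficients $\binom{m}{i}$ are taken to be $0$ for $i<0$ and for $i>m$. The sequence is OEIS A052975 (counting certain paths on the path graph $P_6$). -}

module Defs where

open import Data.Nat using (ℕ; zero; suc; _+_; _*_; _%_)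
open import Data.Nat.Combinatorics using (_C_)
open import Data.Integer as ℤ using (ℤ; +_)
open import Data.List using (List; map; upTo; filter)
open import Data.Integer using () renaming (_+_ to _+ℤ_)
open import Relation.Nullary.Decidable using (_⊎-dec_)
open import Data.Nat using (_≟_)

R : ℕ → ℤ
R 0 = + 1
R 1 = + 2
R 2 = + 6
R (suc (suc (suc n))) =
  ((+ 5) ℤ.* R (suc (suc n)) ℤ.- (+ 6) ℤ.* R (suc n)) ℤ.+ R n

-- sum of C(2n, n+k) over k in {0, ..., n} satisfying a decidable predicate
-- on k; terms with k > n are zero (binomial vanishes), so this is the
-- full sum over k ≥ 0.
sumℤ : List ℤ → ℤ
sumℤ = Data.List.foldr _+ℤ_ (+ 0)

S0 : ℕ → ℤ
S0 n = sumℤ (map (λ k → + ((2 * n) C (n + k)))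
                 (filter (λ k → (k % 7) ≟ 0) (upTo (suc n))))

S34 : ℕ → ℤ
S34 n = sumℤ (map (λ k → + ((2 * n) C (n + k)))
                  (filter (λ k → ((k % 7) ≟ 3) ⊎-dec ((k % 7) ≟ 4)) (upTo (suc n))))

-- For a weight w : ℕ → ℤ put  weighted w n = Σ_{0 ≤ k ≤ n} w k · C(2n, n+k).
-- Pascal's rule applied twice gives C(2n+2, n+k+1) = C(2n, n+k-1) + 2 C(2n, n+k) + C(2n, n+k+1),
-- so  weighted w (n+1) = weighted (T w) n  for the transfer operator T of the walk with
-- steps -1, 0, 0, +1 on ℕ, reflected at 0 (because C(2n, n-1) = C(2n, n+1)).
-- The right-hand side of the theorem is  weighted W n  for a weight W that is 7-periodic
-- away from 0, and W satisfies  T³W = 5 T²W - 6 TW + W  pointwise (a finite check by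
-- periodicity); by linearity, weighted W then obeys R's recurrence.

module Submission where

open import Defs
open import Data.Nat using (ℕ)
import Data.Nat as ℕ
open import Data.Nat.Combinatorics using (_C_)
open import Data.Integer using (ℤ; +_; _-_; _*_)
open import Relation.Binary.PropositionalEquality using (_≡_)

open import Data.Nat using (zero; suc; _<_; _%_; _≟_)
import Data.Nat.Properties as ℕ
open import Data.Nat.Combinatorics using (nCk+nC[k+1]≡[n+1]C[k+1]; nCk≡nC[n∸k]; k>n⇒nCk≡0)
open import Data.Nat.DivMod using ([m+n]%n≡m%n)
open import Data.Integer using (_+_; -_)
import Data.Integer.Properties as ℤ
open import Data.Integer.Tactic.RingSolver using (solve-∀)
open import Data.List using ([]; _∷_; map; filter; upTo; applyUpTo)
open import Data.List.Properties using (map-applyUpTo)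
open import Data.Product using (_×_; _,_; proj₁)
open import Function using (_∘_)
open import Relation.Nullary using (Dec; yes; no)
open import Relation.Unary using (Pred; Decidable)
open import Relation.Nullary.Decidable using (_⊎-dec_)
open import Relation.Binary.PropositionalEquality using (refl; sym; trans; cong; cong₂; module ≡-Reasoning)
open ≡-Reasoning

∑ : ℕ → (ℕ → ℤ) → ℤ
∑ zero    f = + 0
∑ (suc m) f = f 0 + ∑ m (f ∘ suc)

∑-cong : ∀ m {f g : ℕ → ℤ} → (∀ k → f k ≡ g k) → ∑ m f ≡ ∑ m g
∑-cong zero    f≗g = refl
∑-cong (suc m) f≗g = cong₂ _+_ (f≗g 0) (∑-cong m (f≗g ∘ suc))

∑-0 : ∀ m → ∑ m (λ _ → + 0) ≡ + 0
∑-0 zero    = refl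
∑-0 (suc m) = trans (ℤ.+-identityˡ _) (∑-0 m)

∑-+ : ∀ m (f g : ℕ → ℤ) → ∑ m (λ k → f k + g k) ≡ ∑ m f + ∑ m g
∑-+ zero    f g = refl
∑-+ (suc m) f g = begin
  f 0 + g 0 + ∑ m (λ k → f (suc k) + g (suc k)) ≡⟨ cong (_+_ (f 0 + g 0)) (∑-+ m (f ∘ suc) (g ∘ suc)) ⟩
  f 0 + g 0 + (∑ m (f ∘ suc) + ∑ m (g ∘ suc))   ≡⟨ interchange (f 0) (g 0) _ _ ⟩
  f 0 + ∑ m (f ∘ suc) + (g 0 + ∑ m (g ∘ suc))   ∎
  where
  interchange : ∀ a b c d → a + b + (c + d) ≡ a + c + (b + d)
  interchange = solve-∀

∑-*ˡ : ∀ m a (f : ℕ → ℤ) → ∑ m (λ k → a * f k) ≡ a * ∑ m f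
∑-*ˡ zero    a f = sym (ℤ.*-zeroʳ a)
∑-*ˡ (suc m) a f = trans (cong (_+_ (a * f 0)) (∑-*ˡ m a (f ∘ suc)))
                         (sym (ℤ.*-distribˡ-+ a (f 0) (∑ m (f ∘ suc))))

∑-neg : ∀ m (f : ℕ → ℤ) → ∑ m (λ k → - f k) ≡ - ∑ m f
∑-neg zero    f = refl
∑-neg (suc m) f = trans (cong (_+_ (- f 0)) (∑-neg m (f ∘ suc)))
                        (sym (ℤ.neg-distrib-+ (f 0) (∑ m (f ∘ suc))))

∑-snoc : ∀ m (f : ℕ → ℤ) → ∑ (suc m) f ≡ ∑ m f + f m
∑-snoc zero    f = trans (ℤ.+-identityʳ (f 0)) (sym (ℤ.+-identityˡ (f 0)))
∑-snoc (suc m) f = trans (cong (_+_ (f 0)) (∑-snoc m (f ∘ suc)))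
                         (sym (ℤ.+-assoc (f 0) (∑ m (f ∘ suc)) (f (suc m))))

∑-vanishing-last : ∀ m (f : ℕ → ℤ) → f m ≡ + 0 → ∑ (suc m) f ≡ ∑ m f
∑-vanishing-last m f fm≡0 =
  trans (∑-snoc m f) (trans (cong (_+_ (∑ m f)) fm≡0) (ℤ.+-identityʳ (∑ m f)))

sumℤ-applyUpTo : ∀ (f : ℕ → ℤ) m → sumℤ (applyUpTo f m) ≡ ∑ m f
sumℤ-applyUpTo f zero    = refl
sumℤ-applyUpTo f (suc m) = cong (_+_ (f 0)) (sumℤ-applyUpTo (f ∘ suc) m)

indicator : ∀ {P : Set} → Dec P → ℤ
indicator (yes _) = + 1
indicator (no _)  = + 0

sumℤ-filter : ∀ {P : Pred ℕ _} (P? : Decidable P) (f : ℕ → ℤ) xs →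
  sumℤ (map f (filter P? xs)) ≡ sumℤ (map (λ k → indicator (P? k) * f k) xs)
sumℤ-filter P? f []       = refl
sumℤ-filter P? f (x ∷ xs) with P? x
... | yes _ = cong₂ _+_ (sym (ℤ.*-identityˡ (f x))) (sumℤ-filter P? f xs)
... | no _  = trans (sumℤ-filter P? f xs) (sym (ℤ.+-identityˡ _))

sumℤ-filter-upTo : ∀ {P : Pred ℕ _} (P? : Decidable P) (f : ℕ → ℤ) m →
  sumℤ (map f (filter P? (upTo m))) ≡ ∑ m (λ k → indicator (P? k) * f k)
sumℤ-filter-upTo P? f m = begin
  sumℤ (map f (filter P? (upTo m)))                        ≡⟨ sumℤ-filter P? f (upTo m) ⟩
  sumℤ (map (λ k → indicator (P? k) * f k) (upTo m))       ≡⟨ cong sumℤ (map-applyUpTo (λ k → k) _ m) ⟩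
  sumℤ (applyUpTo (λ k → indicator (P? k) * f k) m)        ≡⟨ sumℤ-applyUpTo _ m ⟩
  ∑ m (λ k → indicator (P? k) * f k)                       ∎

pascal : ∀ n k → + (suc n C suc k) ≡ + (n C k) + + (n C suc k)
pascal n k = trans (cong +_ (sym (nCk+nC[k+1]≡[n+1]C[k+1] n k))) (ℤ.pos-+ (n C k) (n C suc k))

pascal² : ∀ n k →
  + (suc (suc n) C suc (suc k)) ≡ + (n C k) + + 2 * + (n C suc k) + + (n C suc (suc k))
pascal² n k = begin
  + (suc (suc n) C suc (suc k))                                  ≡⟨ pascal (suc n) (suc k) ⟩
  + (suc n C suc k) + + (suc n C suc (suc k))                    ≡⟨ cong₂ _+_ (pascal n k) (pascal n (suc k)) ⟩
  + (n C k) + + (n C suc k) + (+ (n C suc k) + + (n C suc (suc k))) ≡⟨ collect (+ (n C k)) (+ (n C suc k)) (+ (n C suc (suc k))) ⟩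
  + (n C k) + + 2 * + (n C suc k) + + (n C suc (suc k))          ∎
  where
  collect : ∀ a b c → a + b + (b + c) ≡ a + + 2 * b + c
  collect = solve-∀

[2n+1]Cn≡[2n+1]C[n+1] : ∀ n → suc (2 ℕ.* n) C n ≡ suc (2 ℕ.* n) C suc n
[2n+1]Cn≡[2n+1]C[n+1] n = trans (nCk≡nC[n∸k] n≤2n+1) (cong (suc (2 ℕ.* n) C_) 2n+1∸n≡n+1)
  where
  n≤2n+1 : n ℕ.≤ suc (2 ℕ.* n)
  n≤2n+1 = ℕ.≤-trans (ℕ.m≤m+n n (n ℕ.+ 0)) (ℕ.n≤1+n _)
  2n+1∸n≡n+1 : suc (2 ℕ.* n) ℕ.∸ n ≡ suc n
  2n+1∸n≡n+1 = begin
    suc (n ℕ.+ (n ℕ.+ 0)) ℕ.∸ n ≡⟨ cong (λ m → m ℕ.∸ n) (sym (ℕ.+-suc n (n ℕ.+ 0))) ⟩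
    n ℕ.+ suc (n ℕ.+ 0) ℕ.∸ n   ≡⟨ ℕ.m+n∸m≡n n (suc (n ℕ.+ 0)) ⟩
    suc (n ℕ.+ 0)               ≡⟨ cong suc (ℕ.+-identityʳ n) ⟩
    suc n                       ∎

[2n+2]C[n+1]≡2*[2n]Cn+2*[2n]C[n+1] : ∀ n →
  + (suc (suc (2 ℕ.* n)) C suc n) ≡ + 2 * + (2 ℕ.* n C n) + + 2 * + (2 ℕ.* n C suc n)
[2n+2]C[n+1]≡2*[2n]Cn+2*[2n]C[n+1] n = begin
  + (suc (suc (2 ℕ.* n)) C suc n)                          ≡⟨ pascal (suc (2 ℕ.* n)) n ⟩
  + (suc (2 ℕ.* n) C n) + + (suc (2 ℕ.* n) C suc n)        ≡⟨ cong (λ m → + m + + (suc (2 ℕ.* n) C suc n))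
                                                                   ([2n+1]Cn≡[2n+1]C[n+1] n) ⟩
  + (suc (2 ℕ.* n) C suc n) + + (suc (2 ℕ.* n) C suc n)    ≡⟨ cong (λ m → m + m) (pascal (2 ℕ.* n) n) ⟩
  (a + b) + (a + b)                                        ≡⟨ double a b ⟩
  + 2 * a + + 2 * b                                        ∎
  where
  a = + (2 ℕ.* n C n)
  b = + (2 ℕ.* n C suc n)
  double : ∀ a b → (a + b) + (a + b) ≡ + 2 * a + + 2 * b
  double = solve-∀

B : ℕ → ℕ → ℤ
B n k = + (2 ℕ.* n C (n ℕ.+ k))

B-suc : ∀ n k → B n (suc k) ≡ + (2 ℕ.* n C suc (n ℕ.+ k))
B-suc n k = cong (λ i → + (2 ℕ.* n C i)) (ℕ.+-suc n k)

B-suc-suc : ∀ n k → B (suc n) (suc k) ≡ B n k + + 2 * B n (suc k) + B n (suc (suc k))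
B-suc-suc n k = begin
  B (suc n) (suc k)                                      ≡⟨ cong₂ (λ m i → + (m C i)) (ℕ.*-suc 2 n)
                                                                  (cong suc (ℕ.+-suc n k)) ⟩
  + (suc (suc (2 ℕ.* n)) C suc (suc (n ℕ.+ k)))          ≡⟨ pascal² (2 ℕ.* n) (n ℕ.+ k) ⟩
  B n k + + 2 * + (2 ℕ.* n C suc (n ℕ.+ k)) + + (2 ℕ.* n C suc (suc (n ℕ.+ k)))
    ≡⟨ sym (cong₂ (λ b c → B n k + + 2 * b + c) (B-suc n k) B-suc-suc-index) ⟩
  B n k + + 2 * B n (suc k) + B n (suc (suc k))          ∎
  where
  B-suc-suc-index : B n (suc (suc k)) ≡ + (2 ℕ.* n C suc (suc (n ℕ.+ k)))
  B-suc-suc-index = trans (B-suc n (suc k)) (cong (λ i → + (2 ℕ.* n C suc i)) (ℕ.+-suc n k))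

B-suc-zero : ∀ n → B (suc n) 0 ≡ + 2 * B n 0 + + 2 * B n 1
B-suc-zero n = begin
  B (suc n) 0                                            ≡⟨ cong₂ (λ m i → + (m C i)) (ℕ.*-suc 2 n)
                                                                  (ℕ.+-identityʳ (suc n)) ⟩
  + (suc (suc (2 ℕ.* n)) C suc n)                        ≡⟨ [2n+2]C[n+1]≡2*[2n]Cn+2*[2n]C[n+1] n ⟩
  + 2 * + (2 ℕ.* n C n) + + 2 * + (2 ℕ.* n C suc n)      ≡⟨ sym (cong₂ (λ i j → + 2 * + (2 ℕ.* n C i) + + 2 * + (2 ℕ.* n C j))
                                                                       (ℕ.+-identityʳ n) (ℕ.+-comm n 1)) ⟩
  + 2 * B n 0 + + 2 * B n 1                              ∎

B-vanish : ∀ {n k} → n < k → B n k ≡ + 0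
B-vanish {n} {k} n<k = cong +_ (k>n⇒nCk≡0 (ℕ.+-monoʳ-< n n+0<k))
  where
  n+0<k : n ℕ.+ 0 < k
  n+0<k = ℕ.≤-trans (ℕ.s≤s (ℕ.≤-reflexive (ℕ.+-identityʳ n))) n<k

*-B-vanish : ∀ a {n k} → n < k → a * B n k ≡ + 0
*-B-vanish a n<k = trans (cong (a *_) (B-vanish n<k)) (ℤ.*-zeroʳ a)

weighted : (ℕ → ℤ) → ℕ → ℤ
weighted w n = ∑ (suc n) (λ k → w k * B n k)

weighted-cong : ∀ n {v w : ℕ → ℤ} → (∀ k → v k ≡ w k) → weighted v n ≡ weighted w n
weighted-cong n v≗w = ∑-cong (suc n) (λ k → cong (_* B n k) (v≗w k))

weighted-+ : ∀ n (v w : ℕ → ℤ) → weighted (λ k → v k + w k) n ≡ weighted v n + weighted w n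
weighted-+ n v w = trans (∑-cong (suc n) (λ k → ℤ.*-distribʳ-+ (B n k) (v k) (w k)))
                         (∑-+ (suc n) (λ k → v k * B n k) (λ k → w k * B n k))

weighted-* : ∀ n a (w : ℕ → ℤ) → weighted (λ k → a * w k) n ≡ a * weighted w n
weighted-* n a w = trans (∑-cong (suc n) (λ k → ℤ.*-assoc a (w k) (B n k)))
                         (∑-*ˡ (suc n) a (λ k → w k * B n k))

weighted-- : ∀ n (v w : ℕ → ℤ) → weighted (λ k → v k - w k) n ≡ weighted v n - weighted w n
weighted-- n v w = begin
  weighted (λ k → v k - w k) n         ≡⟨ weighted-+ n v (λ k → - w k) ⟩
  weighted v n + weighted (-_ ∘ w) n   ≡⟨ cong (_+_ (weighted v n)) weighted-neg ⟩
  weighted v n - weighted w n          ∎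
  where
  weighted-neg : weighted (-_ ∘ w) n ≡ - weighted w n
  weighted-neg = trans (∑-cong (suc n) (λ k → sym (ℤ.neg-distribˡ-* (w k) (B n k))))
                       (∑-neg (suc n) (λ k → w k * B n k))

shiftʳ : (ℕ → ℤ) → ℕ → ℤ
shiftʳ w zero    = + 0
shiftʳ w (suc k) = w k

-- The term C(2n, n-1) = C(2n, n+1) of the step from k = 0 to -1, folded onto k = 1.
reflection : (ℕ → ℤ) → ℕ → ℤ
reflection w 1 = w 0
reflection w _ = + 0

transfer : (ℕ → ℤ) → ℕ → ℤ
transfer w k = w (suc k) + + 2 * w k + shiftʳ w k + reflection w k

weighted-transfer : ∀ w n → weighted (transfer w) n ≡
  weighted (w ∘ suc) n + + 2 * weighted w n + weighted (shiftʳ w) n + weighted (reflection w) n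
weighted-transfer w n = begin
  weighted (transfer w) n
    ≡⟨ weighted-+ n (λ k → w (suc k) + + 2 * w k + shiftʳ w k) (reflection w) ⟩
  weighted (λ k → w (suc k) + + 2 * w k + shiftʳ w k) n + weighted (reflection w) n
    ≡⟨ cong (_+ weighted (reflection w) n) (weighted-+ n (λ k → w (suc k) + + 2 * w k) (shiftʳ w)) ⟩
  weighted (λ k → w (suc k) + + 2 * w k) n + weighted (shiftʳ w) n + weighted (reflection w) n
    ≡⟨ cong (λ x → x + weighted (shiftʳ w) n + weighted (reflection w) n)
            (trans (weighted-+ n (w ∘ suc) (λ k → + 2 * w k)) (cong (_+_ (weighted (w ∘ suc) n)) (weighted-* n (+ 2) w))) ⟩
  weighted (w ∘ suc) n + + 2 * weighted w n + weighted (shiftʳ w) n + weighted (reflection w) n ∎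

weighted-shiftʳ : ∀ w n →
  weighted (shiftʳ w) n ≡ w 0 * B n 1 + ∑ n (λ k → w (suc k) * B n (suc (suc k)))
weighted-shiftʳ w n = begin
  + 0 + ∑ n (λ k → w k * B n (suc k))                       ≡⟨ ℤ.+-identityˡ _ ⟩
  ∑ n (λ k → w k * B n (suc k))                             ≡⟨ sym (∑-vanishing-last n _ (*-B-vanish (w n) (ℕ.n<1+n n))) ⟩
  w 0 * B n 1 + ∑ n (λ k → w (suc k) * B n (suc (suc k)))   ∎

weighted-reflection : ∀ w n → weighted (reflection w) n ≡ w 0 * B n 1
weighted-reflection w zero    = trans (ℤ.+-identityʳ (+ 0)) (sym (*-B-vanish (w 0) {0} {1} (ℕ.s≤s ℕ.z≤n)))
weighted-reflection w (suc n) = begin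
  + 0 + (w 0 * B (suc n) 1 + ∑ n (λ _ → + 0))   ≡⟨ ℤ.+-identityˡ _ ⟩
  w 0 * B (suc n) 1 + ∑ n (λ _ → + 0)           ≡⟨ cong (_+_ (w 0 * B (suc n) 1)) (∑-0 n) ⟩
  w 0 * B (suc n) 1 + + 0                       ≡⟨ ℤ.+-identityʳ _ ⟩
  w 0 * B (suc n) 1                             ∎

weighted-suc-expand : ∀ w n → weighted w (suc n) ≡
  w 0 * (+ 2 * B n 0 + + 2 * B n 1) +
  (weighted (w ∘ suc) n + + 2 * ∑ n (λ k → w (suc k) * B n (suc k)) + ∑ n (λ k → w (suc k) * B n (suc (suc k))))
weighted-suc-expand w n = begin
  w 0 * B (suc n) 0 + ∑ (suc n) (λ k → w (suc k) * B (suc n) (suc k))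
    ≡⟨ cong₂ _+_ (cong (w 0 *_) (B-suc-zero n)) (∑-cong (suc n) (λ k → cong (w (suc k) *_) (B-suc-suc n k))) ⟩
  w 0 * (+ 2 * B n 0 + + 2 * B n 1) + ∑ (suc n) (λ k → w (suc k) * (B n k + + 2 * B n (suc k) + B n (suc (suc k))))
    ≡⟨ cong (_+_ (w 0 * (+ 2 * B n 0 + + 2 * B n 1))) split ⟩
  w 0 * (+ 2 * B n 0 + + 2 * B n 1) + (∑ (suc n) a + + 2 * ∑ n b + ∑ n c) ∎
  where
  a b c : ℕ → ℤ
  a k = w (suc k) * B n k
  b k = w (suc k) * B n (suc k)
  c k = w (suc k) * B n (suc (suc k))
  distribute : ∀ x p q r → x * (p + + 2 * q + r) ≡ x * p + + 2 * (x * q) + x * r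
  distribute = solve-∀
  b-last : ∑ (suc n) b ≡ ∑ n b
  b-last = ∑-vanishing-last n b (*-B-vanish (w (suc n)) (ℕ.n<1+n n))
  c-last : ∑ (suc n) c ≡ ∑ n c
  c-last = ∑-vanishing-last n c (*-B-vanish (w (suc n)) (ℕ.m≤n⇒m≤1+n (ℕ.n<1+n n)))
  split : ∑ (suc n) (λ k → w (suc k) * (B n k + + 2 * B n (suc k) + B n (suc (suc k)))) ≡
          ∑ (suc n) a + + 2 * ∑ n b + ∑ n c
  split = begin
    ∑ (suc n) (λ k → w (suc k) * (B n k + + 2 * B n (suc k) + B n (suc (suc k))))
      ≡⟨ ∑-cong (suc n) (λ k → distribute (w (suc k)) (B n k) (B n (suc k)) (B n (suc (suc k)))) ⟩
    ∑ (suc n) (λ k → a k + + 2 * b k + c k)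
      ≡⟨ ∑-+ (suc n) (λ k → a k + + 2 * b k) c ⟩
    ∑ (suc n) (λ k → a k + + 2 * b k) + ∑ (suc n) c
      ≡⟨ cong (_+ ∑ (suc n) c) (∑-+ (suc n) a (λ k → + 2 * b k)) ⟩
    ∑ (suc n) a + ∑ (suc n) (λ k → + 2 * b k) + ∑ (suc n) c
      ≡⟨ cong₂ (λ p q → ∑ (suc n) a + p + q) (trans (∑-*ˡ (suc n) (+ 2) b) (cong (+ 2 *_) b-last)) c-last ⟩
    ∑ (suc n) a + + 2 * ∑ n b + ∑ n c ∎

weighted-suc : ∀ w n → weighted w (suc n) ≡ weighted (transfer w) n
weighted-suc w n = begin
  weighted w (suc n)
    ≡⟨ weighted-suc-expand w n ⟩
  w 0 * (+ 2 * B n 0 + + 2 * B n 1) + (X + + 2 * P + C)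
    ≡⟨ regroup (w 0) (B n 0) (B n 1) X P C ⟩
  X + + 2 * (w 0 * B n 0 + P) + (w 0 * B n 1 + C) + w 0 * B n 1
    ≡⟨ sym (cong₂ (λ s r → X + + 2 * (w 0 * B n 0 + P) + s + r) (weighted-shiftʳ w n) (weighted-reflection w n)) ⟩
  X + + 2 * weighted w n + weighted (shiftʳ w) n + weighted (reflection w) n
    ≡⟨ sym (weighted-transfer w n) ⟩
  weighted (transfer w) n ∎
  where
  X = weighted (w ∘ suc) n
  P = ∑ n (λ k → w (suc k) * B n (suc k))
  C = ∑ n (λ k → w (suc k) * B n (suc (suc k)))
  regroup : ∀ w₀ b₀ b₁ x p c →
    w₀ * (+ 2 * b₀ + + 2 * b₁) + (x + + 2 * p + c) ≡ x + + 2 * (w₀ * b₀ + p) + (w₀ * b₁ + c) + w₀ * b₁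
  regroup = solve-∀

period7 : ℕ → ℤ
period7 0 = + 2
period7 1 = + 0
period7 2 = + 0
period7 3 = - + 1
period7 4 = - + 1
period7 5 = + 0
period7 6 = + 0
period7 (suc (suc (suc (suc (suc (suc (suc k))))))) = period7 k

W : ℕ → ℤ
W 0       = + 1
W (suc k) = period7 (suc k)

T : (ℕ → ℤ) → ℕ → ℤ
T = transfer

-- From k = 4 on, both sides only see W on indices ≥ 1, where it is 7-periodic.
T³W-recurrence : ∀ k → T (T (T W)) k ≡ (+ 5 * T (T W) k - + 6 * T W k) + W k
T³W-recurrence 0 = refl
T³W-recurrence 1 = refl
T³W-recurrence 2 = refl
T³W-recurrence 3 = refl
T³W-recurrence (suc (suc (suc (suc j)))) = periodic j
  where
  periodic : ∀ j → let k = suc (suc (suc (suc j))) in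
    T (T (T W)) k ≡ (+ 5 * T (T W) k - + 6 * T W k) + W k
  periodic 0 = refl
  periodic 1 = refl
  periodic 2 = refl
  periodic 3 = refl
  periodic 4 = refl
  periodic 5 = refl
  periodic 6 = refl
  periodic (suc (suc (suc (suc (suc (suc (suc j))))))) = periodic j

weighted-W-recurrence : ∀ n →
  weighted W (suc (suc (suc n))) ≡ (+ 5 * weighted W (suc (suc n)) - + 6 * weighted W (suc n)) + weighted W n
weighted-W-recurrence n = begin
  weighted W (suc (suc (suc n)))
    ≡⟨ trans (weighted-suc W (suc (suc n))) (trans (weighted-suc (T W) (suc n)) (weighted-suc (T (T W)) n)) ⟩
  weighted (T (T (T W))) n
    ≡⟨ weighted-cong n T³W-recurrence ⟩
  weighted (λ k → (+ 5 * T (T W) k - + 6 * T W k) + W k) n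
    ≡⟨ trans (weighted-+ n (λ k → + 5 * T (T W) k - + 6 * T W k) W)
             (cong (_+ weighted W n) (weighted-- n (λ k → + 5 * T (T W) k) (λ k → + 6 * T W k))) ⟩
  (weighted (λ k → + 5 * T (T W) k) n - weighted (λ k → + 6 * T W k) n) + weighted W n
    ≡⟨ cong₂ (λ a b → (a - b) + weighted W n) (weighted-* n (+ 5) (T (T W))) (weighted-* n (+ 6) (T W)) ⟩
  (+ 5 * weighted (T (T W)) n - + 6 * weighted (T W) n) + weighted W n
    ≡⟨ sym (cong₂ (λ a b → (+ 5 * a - + 6 * b) + weighted W n)
                  (trans (weighted-suc W (suc n)) (weighted-suc (T W) n)) (weighted-suc W n)) ⟩
  (+ 5 * weighted W (suc (suc n)) - + 6 * weighted W (suc n)) + weighted W n ∎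

R-unique : (f : ℕ → ℤ) → f 0 ≡ + 1 → f 1 ≡ + 2 → f 2 ≡ + 6 →
  (∀ n → f (suc (suc (suc n))) ≡ (+ 5 * f (suc (suc n)) - + 6 * f (suc n)) + f n) →
  ∀ n → R n ≡ f n
R-unique f f₀ f₁ f₂ f-rec n = proj₁ (three n)
  where
  three : ∀ n → R n ≡ f n × R (suc n) ≡ f (suc n) × R (suc (suc n)) ≡ f (suc (suc n))
  three zero    = sym f₀ , sym f₁ , sym f₂
  three (suc n) = let (e₀ , e₁ , e₂) = three n in
    e₁ , e₂ , trans (cong₂ (λ a b → (+ 5 * a - + 6 * b) + R n) e₂ e₁)
                    (trans (cong (_+_ (+ 5 * f (suc (suc n)) - + 6 * f (suc n))) e₀) (sym (f-rec n)))

χ₀ : ℕ → ℤ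
χ₀ k = indicator ((k % 7) ≟ 0)

χ₃₄ : ℕ → ℤ
χ₃₄ k = indicator (((k % 7) ≟ 3) ⊎-dec ((k % 7) ≟ 4))

period7≡2χ₀-χ₃₄ : ∀ k → period7 k ≡ + 2 * χ₀ k - χ₃₄ k
period7≡2χ₀-χ₃₄ 0 = refl
period7≡2χ₀-χ₃₄ 1 = refl
period7≡2χ₀-χ₃₄ 2 = refl
period7≡2χ₀-χ₃₄ 3 = refl
period7≡2χ₀-χ₃₄ 4 = refl
period7≡2χ₀-χ₃₄ 5 = refl
period7≡2χ₀-χ₃₄ 6 = refl
period7≡2χ₀-χ₃₄ (suc (suc (suc (suc (suc (suc (suc k))))))) =
  trans (period7≡2χ₀-χ₃₄ k) (cong (λ r → + 2 * indicator (r ≟ 0) - indicator ((r ≟ 3) ⊎-dec (r ≟ 4))) (sym k+7%7≡k%7))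
  where
  k+7%7≡k%7 : (7 ℕ.+ k) % 7 ≡ k % 7
  k+7%7≡k%7 = trans (cong (_% 7) (ℕ.+-comm 7 k)) ([m+n]%n≡m%n k 7)

S0≡weighted-χ₀ : ∀ n → S0 n ≡ weighted χ₀ n
S0≡weighted-χ₀ n = sumℤ-filter-upTo (λ k → (k % 7) ≟ 0) (B n) (suc n)

S34≡weighted-χ₃₄ : ∀ n → S34 n ≡ weighted χ₃₄ n
S34≡weighted-χ₃₄ n = sumℤ-filter-upTo (λ k → ((k % 7) ≟ 3) ⊎-dec ((k % 7) ≟ 4)) (B n) (suc n)

weighted-W : ∀ n → weighted W n ≡ + 2 * S0 n - S34 n - + (2 ℕ.* n C n)
weighted-W n = begin
  weighted W n                                     ≡⟨ drop-zero (B n 0) (∑ n (λ k → period7 (suc k) * B n (suc k))) ⟩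
  weighted period7 n - B n 0                       ≡⟨ cong (_- B n 0) (weighted-cong n period7≡2χ₀-χ₃₄) ⟩
  weighted (λ k → + 2 * χ₀ k - χ₃₄ k) n - B n 0    ≡⟨ cong (_- B n 0) (trans (weighted-- n (λ k → + 2 * χ₀ k) χ₃₄)
                                                                              (cong (_- weighted χ₃₄ n) (weighted-* n (+ 2) χ₀))) ⟩
  + 2 * weighted χ₀ n - weighted χ₃₄ n - B n 0     ≡⟨ sym (cong₂ (λ s₀ s₃₄ → + 2 * s₀ - s₃₄ - B n 0)
                                                                 (S0≡weighted-χ₀ n) (S34≡weighted-χ₃₄ n)) ⟩
  + 2 * S0 n - S34 n - B n 0                       ≡⟨ cong (λ i → + 2 * S0 n - S34 n - + (2 ℕ.* n C i)) (ℕ.+-identityʳ n) ⟩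
  + 2 * S0 n - S34 n - + (2 ℕ.* n C n)             ∎
  where
  drop-zero : ∀ b s → + 1 * b + s ≡ (+ 2 * b + s) - b
  drop-zero = solve-∀

mainTheorem6 : (n : ℕ) → R n ≡ (((+ 2) * S0 n) - S34 n) - (+ ((2 ℕ.* n) C n))
mainTheorem6 n = trans (R-unique (weighted W) refl refl refl weighted-W-recurrence n) (weighted-W n)
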